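{- Let $k\ge 2$ and let $B_k^*$ be the complete binary tree with $k$ levels (and $2^k-1$ vertices). Then $k\le cfc(B_k^*)\le 2k-2$.
   Context: For an edge-colored graph, a path is conflict-free if some color occurs on exactly one of its edges; $cfc(G)$ is the minimum number of colors in an edge-coloring of the connected graph $G$ in which every pair of distinct vertices is joined by a conflict-free path. -}

module Defs where

open import Data.Nat using (ℕ; zero; suc; _+_; _*_; _∸_; _^_)
open import Data.Fin using (Fin; toℕ)
open import Data.Fin.Properties renaming (_≟_ to _≟ᶠ_)
open import Data.List using (List; []; _∷_)
open import Data.List.Relation.Unary.Unique.Propositional using (Unique)
open import Data.Product using (Σ; ∃; _×_)
open import Data.Sum using (_⊎_)
open import Relation.Binary.PropositionalEquality using (_≡_; _≢_)
open import Relation.Nullary using (yes; no)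

record Graph : Set₁ where
  field
    n   : ℕ
    Adj : Fin n → Fin n → Set

open Graph public

-- A path from u is given by the list of the vertices visited after u.
-- Its end vertex:
endpoint : ∀ {n} → Fin n → List (Fin n) → Fin n
endpoint u []       = u
endpoint u (w ∷ ws) = endpoint w ws

data Walk (G : Graph) : Fin (n G) → List (Fin (n G)) → Set where
  stop : ∀ {u} → Walk G u []
  step : ∀ {u w ws} → Adj G u w → Walk G w ws → Walk G u (w ∷ ws)

IsPath : (G : Graph) → Fin (n G) → List (Fin (n G)) → Fin (n G) → Set
IsPath G u ws v = Walk G u ws × Unique (u ∷ ws) × endpoint u ws ≡ v

edgeColours : ∀ {n m} → (Fin n → Fin n → Fin m) → Fin n → List (Fin n) → List (Fin m)
edgeColours col u []       = []
edgeColours col u (w ∷ ws) = col u w ∷ edgeColours col w ws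

occ : ∀ {m} → Fin m → List (Fin m) → ℕ
occ c []       = 0
occ c (d ∷ ds) with c ≟ᶠ d
... | yes _ = suc (occ c ds)
... | no  _ = occ c ds

ConflictFree : ∀ {n m} → (Fin n → Fin n → Fin m) → Fin n → List (Fin n) → Set
ConflictFree {m = m} col u ws = Σ (Fin m) λ c → occ c (edgeColours col u ws) ≡ 1

-- An edge-colouring with (at most) m colours, i.e. with colours from Fin m, is given by a
-- symmetric function on vertex pairs (only its values on adjacent pairs matter).
CFConnecting : (G : Graph) (m : ℕ) → (Fin (n G) → Fin (n G) → Fin m) → Set
CFConnecting G m col =
  (∀ u v → col u v ≡ col v u) ×
  (∀ u v → u ≢ v → Σ (List (Fin (n G))) λ ws → IsPath G u ws v × ConflictFree col u ws)

-- G admits a conflict-free connecting edge-colouring with m colours.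
-- cfc(G) is the least m with CFColorable G m; hence
--   cfc(G) ≤ m  iff  CFColorable G m'  for some m' ≤ m (equivalently CFColorable G m),
--   k ≤ cfc(G)  iff  ¬ CFColorable G m for all m < k.
CFColorable : Graph → ℕ → Set
CFColorable G m = Σ (Fin (n G) → Fin (n G) → Fin m) λ col → CFConnecting G m col

-- Complete binary tree with k levels, 2^k - 1 vertices.  Vertex i : Fin (2^k ∸ 1)
-- has heap label toℕ i + 1; label a is adjacent to its children 2a and 2a+1.
ChildOf : ℕ → ℕ → Set
ChildOf a b = b ≡ 2 * a ⊎ b ≡ 2 * a + 1

BinTree : ℕ → Graph
BinTree k = record
  { n   = 2 ^ k ∸ 1
  ; Adj = λ u v → ChildOf (suc (toℕ u)) (suc (toℕ v)) ⊎ ChildOf (suc (toℕ v)) (suc (toℕ u))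
  }

module Submission where

-- Given an edge-colouring with m colours, call a map Q from vertices to parity
-- vectors (Fin m → Parity) a potential if [colour of uw = c] = Q u c ⊕ Q w c for every edge.
-- Along a walk the parity of each colour then telescopes to Q u c ⊕ Q v c, so no path between
-- two vertices of equal potential is conflict-free.  In a tree the parities of the colours on
-- the path from the root form a potential; as there are only 2^m parity vectors but
-- 2^k - 1 > 2^m vertices when m < k, pigeonhole yields two vertices not joined conflict-free.
--
-- With heap labels (the children of a are 2a and 2a+1), colour the edge from y up
-- to its parent by 2d or 2d+1, where d is the depth of the parent and the parity of y tells
-- left from right child: 2k - 2 colours.  The path between u ≠ v climbs to their lowest common
-- ancestor L and descends.  Its lower edge ends all lie strictly below L; the one or two
-- children of L on it are siblings of different parity and all others are deeper, so the
-- colour of an edge leaving L occurs exactly once.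

open import Defs
open import Data.Nat using (ℕ; zero; suc; _+_; _*_; _∸_; _^_; _≤_; _<_; z≤n; s≤s; ⌊_/2⌋; _⊔_; parity)
open import Data.Nat.Properties
open import Data.Nat.Logarithm using (⌊log₂_⌋; ⌊log₂⌋-mono-≤; ⌊log₂⌊n/2⌋⌋≡⌊log₂n⌋∸1)
open import Data.Parity.Base using (Parity; 0ℙ; 1ℙ) renaming (_+_ to _⊕_)
import Data.Parity.Properties as ℙ
open import Data.Fin using (Fin; toℕ; fromℕ<; funToFin; finToFun) renaming (zero to fzero; suc to fsuc)
open import Data.Fin.Properties using (toℕ-fromℕ<; toℕ<n; toℕ-injective; pigeonhole; finToFun-funToFin)
  renaming (_≟_ to _≟ᶠ_; <⇒≢ to <⇒≢ᶠ)
open import Data.List using (List; []; _∷_; _++_; map)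
open import Data.List.Properties using (map-++)
open import Data.List.Relation.Unary.All as All using (All; []; _∷_; lookup)
open import Data.List.Relation.Unary.All.Properties using (∷ʳ⁺; map⁺)
open import Data.List.Relation.Unary.AllPairs using ([]; _∷_)
open import Data.List.Relation.Unary.Any using (here; there)
open import Data.List.Relation.Unary.Unique.Propositional using (Unique)
open import Data.List.Membership.Propositional using (_∈_)
open import Data.List.Membership.Propositional.Properties using (∈-++⁺ˡ; ∈-++⁺ʳ)
open import Data.List.Relation.Unary.Unique.Propositional.Properties using (++⁺)
open import Data.Product using (Σ; ∃-syntax; _×_; _,_; proj₁; proj₂)
open import Data.Sum using (inj₁; inj₂; swap)
open import Data.Empty using (⊥-elim)
open import Relation.Nullary using (¬_; yes; no)
open import Relation.Binary.PropositionalEquality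
open import Relation.Binary.Definitions using (tri<; tri≈; tri>)

endpoint-++ : ∀ {k} (u : Fin k) xs ys → endpoint u (xs ++ ys) ≡ endpoint (endpoint u xs) ys
endpoint-++ u []       ys = refl
endpoint-++ u (x ∷ xs) ys = endpoint-++ x xs ys

walk-++ : ∀ {G u} xs {ys} → Walk G u xs → Walk G (endpoint u xs) ys → Walk G u (xs ++ ys)
walk-++ []       stop          rest = rest
walk-++ (x ∷ xs) (step adj wk) rest = step adj (walk-++ xs wk rest)

edgeColours-++ : ∀ {k m} (col : Fin k → Fin k → Fin m) u xs ys →
  edgeColours col u (xs ++ ys) ≡ edgeColours col u xs ++ edgeColours col (endpoint u xs) ys
edgeColours-++ col u []       ys = refl
edgeColours-++ col u (x ∷ xs) ys = cong (col u x ∷_) (edgeColours-++ col x xs ys)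

occ-absent : ∀ {A : Set} {m} (f : A → Fin m) c xs → (∀ {y} → y ∈ xs → f y ≢ c) → occ c (map f xs) ≡ 0
occ-absent f c []       _      = refl
occ-absent f c (y ∷ ys) absent with c ≟ᶠ f y
... | yes c≡fy = ⊥-elim (absent (here refl) (sym c≡fy))
... | no  _    = occ-absent f c ys (λ y∈ys → absent (there y∈ys))

occ-once : ∀ {A : Set} {m} (f : A → Fin m) {w} xs → Unique xs → w ∈ xs →
           (∀ {y} → y ∈ xs → f y ≡ f w → y ≡ w) → occ (f w) (map f xs) ≡ 1
occ-once f {w} (y ∷ ys) (y∉ys ∷ uniq) w∈ only with f w ≟ᶠ f y
... | yes fw≡fy = cong suc (occ-absent f (f w) ys fresh)
  where
    fresh : ∀ {z} → z ∈ ys → f z ≢ f w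
    fresh z∈ys fz≡fw with only (here refl) (sym fw≡fy) | only (there z∈ys) fz≡fw
    ... | refl | refl = lookup y∉ys z∈ys refl
... | no  fw≢fy with w∈
...   | here refl  = ⊥-elim (fw≢fy refl)
...   | there w∈ys = occ-once f ys uniq w∈ys (λ y∈ys → only (there y∈ys))

unique-map : ∀ {A B : Set} {P : A → Set} (f : A → B) {xs} →
             (∀ {x y} → P x → P y → f x ≡ f y → x ≡ y) → All P xs → Unique xs → Unique (map f xs)
unique-map f inj []         []           = []
unique-map f inj (px ∷ pxs) (x∉xs ∷ uniq) =
  map⁺ (All.zipWith (λ (py , x≢y) fx≡fy → x≢y (inj px py fx≡fy)) (pxs , x∉xs)) ∷ unique-map f inj pxs uniq

indicator : ∀ {m} → Fin m → Fin m → Parity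
indicator c d with c ≟ᶠ d
... | yes _ = 1ℙ
... | no  _ = 0ℙ

parity-occ-∷ : ∀ {m} (c d : Fin m) ds → parity (occ c (d ∷ ds)) ≡ indicator c d ⊕ parity (occ c ds)
parity-occ-∷ c d ds with c ≟ᶠ d
... | yes _ = ℙ.+-homo-+ 1 (occ c ds)
... | no  _ = refl

Potential : (G : Graph) {m : ℕ} → (Fin (n G) → Fin (n G) → Fin m) → (Fin (n G) → Fin m → Parity) → Set
Potential G col Q = ∀ {u w} → Adj G u w → ∀ c → indicator c (col u w) ≡ Q u c ⊕ Q w c

telescope : ∀ p q r → (p ⊕ q) ⊕ (q ⊕ r) ≡ p ⊕ r
telescope p q r = begin
  (p ⊕ q) ⊕ (q ⊕ r) ≡⟨ ℙ.+-assoc p q (q ⊕ r) ⟩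
  p ⊕ (q ⊕ (q ⊕ r)) ≡⟨ cong (p ⊕_) (sym (ℙ.+-assoc q q r)) ⟩
  p ⊕ ((q ⊕ q) ⊕ r) ≡⟨ cong (λ x → p ⊕ (x ⊕ r)) (ℙ.p+p≡0ℙ q) ⟩
  p ⊕ r             ∎
  where open ≡-Reasoning

⊕-solve : ∀ {p q r} → r ≡ p ⊕ q → p ≡ q ⊕ r
⊕-solve {0ℙ} {0ℙ} refl = refl
⊕-solve {0ℙ} {1ℙ} refl = refl
⊕-solve {1ℙ} {0ℙ} refl = refl
⊕-solve {1ℙ} {1ℙ} refl = refl

module _ {G : Graph} {m : ℕ} {col : Fin (n G) → Fin (n G) → Fin m} {Q : Fin (n G) → Fin m → Parity}
         (pot : Potential G col Q) where

  walk-parity : ∀ {u ws} → Walk G u ws → ∀ c →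
                parity (occ c (edgeColours col u ws)) ≡ Q u c ⊕ Q (endpoint u ws) c
  walk-parity {u} stop c = sym (ℙ.p+p≡0ℙ (Q u c))
  walk-parity {u} {w ∷ ws} (step adj wk) c = begin
    parity (occ c (col u w ∷ edgeColours col w ws))
      ≡⟨ parity-occ-∷ c (col u w) _ ⟩
    indicator c (col u w) ⊕ parity (occ c (edgeColours col w ws))
      ≡⟨ cong₂ _⊕_ (pot adj c) (walk-parity wk c) ⟩
    (Q u c ⊕ Q w c) ⊕ (Q w c ⊕ Q (endpoint w ws) c)
      ≡⟨ telescope (Q u c) (Q w c) _ ⟩
    Q u c ⊕ Q (endpoint w ws) c ∎
    where open ≡-Reasoning

  equal-potential-not-CF : ∀ {u v ws} → (∀ c → Q u c ≡ Q v c) → IsPath G u ws v → ¬ ConflictFree col u ws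
  equal-potential-not-CF {u} {v} {ws} same (wk , _ , end) (c , once) = ℙ.p≢p⁻¹ 1ℙ odd≡even
    where
      odd≡even : 1ℙ ≡ 0ℙ
      odd≡even = begin
        parity 1                               ≡⟨ cong parity once ⟨
        parity (occ c (edgeColours col u ws))  ≡⟨ walk-parity wk c ⟩
        Q u c ⊕ Q (endpoint u ws) c            ≡⟨ cong (λ x → Q u c ⊕ Q x c) end ⟩
        Q u c ⊕ Q v c                          ≡⟨ cong (_⊕ Q v c) (same c) ⟩
        Q v c ⊕ Q v c                          ≡⟨ ℙ.p+p≡0ℙ (Q v c) ⟩
        0ℙ                                     ∎
        where open ≡-Reasoning

bit : Parity → Fin 2
bit 0ℙ = fzero
bit 1ℙ = fsuc fzero

bit-injective : ∀ {p q} → bit p ≡ bit q → p ≡ q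
bit-injective {0ℙ} {0ℙ} _ = refl
bit-injective {1ℙ} {1ℙ} _ = refl

encode : ∀ {m} → (Fin m → Parity) → Fin (2 ^ m)
encode P = funToFin (λ c → bit (P c))

encode-injective : ∀ {m} (P R : Fin m → Parity) → encode P ≡ encode R → ∀ c → P c ≡ R c
encode-injective P R eq c = bit-injective (begin
  bit (P c)                           ≡⟨ sym (finToFun-funToFin (λ c → bit (P c)) c) ⟩
  finToFun (encode P) c               ≡⟨ cong (λ x → finToFun x c) eq ⟩
  finToFun (encode R) c               ≡⟨ finToFun-funToFin (λ c → bit (R c)) c ⟩
  bit (R c)                           ∎)
  where open ≡-Reasoning

potential-lower-bound : (G : Graph) (m : ℕ) → 2 ^ m < n G →
  (∀ col → (∀ u v → col u v ≡ col v u) → Σ (Fin (n G) → Fin m → Parity) (Potential G col)) →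
  ¬ CFColorable G m
potential-lower-bound G m many potential (col , symmetric , connected)
  with potential col symmetric
... | Q , pot with pigeonhole many (λ u → encode (Q u))
...   | u , v , u<v , same with connected u v (<⇒≢ᶠ u<v)
...     | ws , path , cf = equal-potential-not-CF pot (encode-injective (Q u) (Q v) same) path cf

child-of-half : ∀ x → ChildOf ⌊ x /2⌋ x
child-of-half zero          = inj₁ refl
child-of-half (suc zero)    = inj₂ refl
child-of-half (suc (suc x)) with child-of-half x
... | inj₁ even = inj₁ (trans (cong (2 +_) even) (sym (*-suc 2 ⌊ x /2⌋)))
... | inj₂ odd  = inj₂ (trans (cong (2 +_) odd) (cong (_+ 1) (sym (*-suc 2 ⌊ x /2⌋))))

half-of-child : ∀ a {b} → ChildOf a b → ⌊ b /2⌋ ≡ a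
half-of-child zero    (inj₁ refl) = refl
half-of-child zero    (inj₂ refl) = refl
half-of-child (suc a) (inj₁ refl) =
  trans (cong ⌊_/2⌋ (*-suc 2 a)) (cong suc (half-of-child a (inj₁ refl)))
half-of-child (suc a) (inj₂ refl) =
  trans (cong (λ z → ⌊ z + 1 /2⌋) (*-suc 2 a)) (cong suc (half-of-child a (inj₂ refl)))

twice-half-≤ : ∀ x → 2 * ⌊ x /2⌋ ≤ x
twice-half-≤ x with child-of-half x
... | inj₁ even = ≤-reflexive (sym even)
... | inj₂ odd  = ≤-trans (m≤m+n _ 1) (≤-reflexive (sym odd))

half-< : ∀ {x y} → x < 2 * y → ⌊ x /2⌋ < y
half-< {x} x<2y = *-cancelˡ-< 2 _ _ (≤-<-trans (twice-half-≤ x) x<2y)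

half-positive : ∀ {x} → 1 ≤ ⌊ x /2⌋ → 2 ≤ x
half-positive {suc (suc x)} _ = s≤s (s≤s z≤n)

even-parity : ∀ a → parity (2 * a) ≡ 0ℙ
even-parity a = ℙ.*-homo-* 2 a

odd-parity : ∀ a → parity (2 * a + 1) ≡ 1ℙ
odd-parity a = trans (ℙ.+-homo-+ (2 * a) 1) (cong (_⊕ 1ℙ) (even-parity a))

siblings-equal : ∀ {a y w} → ChildOf a y → ChildOf a w → parity y ≡ parity w → y ≡ w
siblings-equal (inj₁ refl) (inj₁ refl) _ = refl
siblings-equal (inj₂ refl) (inj₂ refl) _ = refl
siblings-equal {a} (inj₁ refl) (inj₂ refl) same =
  ⊥-elim (ℙ.p≢p⁻¹ 0ℙ (trans (sym (even-parity a)) (trans same (odd-parity a))))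
siblings-equal {a} (inj₂ refl) (inj₁ refl) same =
  ⊥-elim (ℙ.p≢p⁻¹ 0ℙ (trans (sym (even-parity a)) (trans (sym same) (odd-parity a))))

depth : ℕ → ℕ
depth x = ⌊log₂ x ⌋

depth-half : ∀ {x} → 2 ≤ x → depth x ≡ suc (depth ⌊ x /2⌋)
depth-half {x} 2≤x = begin
  depth x             ≡⟨ suc-∸1 (⌊log₂⌋-mono-≤ 2≤x) ⟨
  suc (depth x ∸ 1)   ≡⟨ cong suc (⌊log₂⌊n/2⌋⌋≡⌊log₂n⌋∸1 x) ⟨
  suc (depth ⌊ x /2⌋) ∎
  where
    open ≡-Reasoning
    suc-∸1 : ∀ {d} → depth 2 ≤ d → suc (d ∸ 1) ≡ d
    suc-∸1 (s≤s _) = refl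

depth-bound : ∀ j x → x < 2 ^ suc j → depth x ≤ j
depth-bound j x x<2^j+1 with x <? 2
... | yes x<2 = ≤-trans (⌊log₂⌋-mono-≤ (≤-pred x<2)) z≤n
depth-bound zero    x x<2 | no x≮2 = ⊥-elim (x≮2 x<2)
depth-bound (suc j) x x<2^j+2 | no x≮2 = begin
  depth x             ≡⟨ depth-half (≮⇒≥ x≮2) ⟩
  suc (depth ⌊ x /2⌋) ≤⟨ s≤s (depth-bound j ⌊ x /2⌋ (half-< x<2^j+2)) ⟩
  suc j               ∎
  where open ≤-Reasoning

ancestor : ℕ → ℕ → ℕ
ancestor x zero    = x
ancestor x (suc i) = ancestor ⌊ x /2⌋ i

ancestor-≤ : ∀ x i → ancestor x i ≤ x
ancestor-≤ x zero    = ≤-refl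
ancestor-≤ x (suc i) = ≤-trans (ancestor-≤ ⌊ x /2⌋ i) (⌊n/2⌋≤n x)

depth-ancestor : ∀ x i → 1 ≤ ancestor x i → depth x ≡ depth (ancestor x i) + i
depth-ancestor x zero    _        = sym (+-identityʳ (depth x))
depth-ancestor x (suc i) positive = begin
  depth x
    ≡⟨ depth-half (half-positive (≤-trans positive (ancestor-≤ ⌊ x /2⌋ i))) ⟩
  suc (depth ⌊ x /2⌋)                      ≡⟨ cong suc (depth-ancestor ⌊ x /2⌋ i positive) ⟩
  suc (depth (ancestor x (suc i)) + i)     ≡⟨ +-suc _ i ⟨
  depth (ancestor x (suc i)) + suc i       ∎
  where open ≡-Reasoning

ancestor-same-depth : ∀ x i {L} → 1 ≤ L → ancestor x i ≡ L → depth x ≡ depth L → x ≡ L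
ancestor-same-depth x zero    _   x≡L _    = x≡L
ancestor-same-depth x (suc i) 1≤L refl same =
  ⊥-elim (m+1+n≢m (depth (ancestor x (suc i))) (trans (sym (depth-ancestor x (suc i) 1≤L)) same))

_≼_ : ℕ → ℕ → Set
L ≼ x = ∃[ i ] ancestor x i ≡ L

-- A route from u to v is built by repeatedly replacing the larger endpoint by its
-- parent until both meet (at their lowest common ancestor, the meeting point).  Read as a
-- path it first climbs from u to the meeting point and then descends to v.

data Route : ℕ → ℕ → Set where
  meet   : ∀ {u} → Route u u
  climbˡ : ∀ {u v} → v < u → Route ⌊ u /2⌋ v → Route u v
  climbʳ : ∀ {u v} → u < v → Route u ⌊ v /2⌋ → Route u v

route : ∀ u v → Route u v
route u v = within (suc (u + v)) u v ≤-refl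
  where
    within : ∀ fuel u v → u + v < fuel → Route u v
    within (suc fuel) u v u+v<fuel with <-cmp u v
    ... | tri≈ _ refl _ = meet
    ... | tri> _ _ v<u@(s≤s _) =
      climbˡ v<u (within fuel ⌊ u /2⌋ v (≤-trans (+-monoˡ-< v (⌊n/2⌋<n _)) (≤-pred u+v<fuel)))
    ... | tri< u<v@(s≤s _) _ _ =
      climbʳ u<v (within fuel u ⌊ v /2⌋ (≤-trans (+-monoʳ-< u (⌊n/2⌋<n _)) (≤-pred u+v<fuel)))

vertices : ∀ {u v} → Route u v → List ℕ
vertices meet                  = []
vertices (climbˡ {u} _ r)      = ⌊ u /2⌋ ∷ vertices r
vertices (climbʳ {v = v} _ r)  = vertices r ++ v ∷ []

lowerEnds : ∀ {u v} → Route u v → List ℕ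
lowerEnds meet                 = []
lowerEnds (climbˡ {u} _ r)     = u ∷ lowerEnds r
lowerEnds (climbʳ {v = v} _ r) = lowerEnds r ++ v ∷ []

meetingPoint : ∀ {u v} → Route u v → ℕ
meetingPoint {u} meet    = u
meetingPoint (climbˡ _ r) = meetingPoint r
meetingPoint (climbʳ _ r) = meetingPoint r

climbˡ-below : ∀ {u v} → v < u → ⌊ u /2⌋ ⊔ v < u
climbˡ-below v<u@(s≤s _) = ⊔-pres-<m (⌊n/2⌋<n _) v<u

climbʳ-below : ∀ {u v} → u < v → u ⊔ ⌊ v /2⌋ < v
climbʳ-below u<v@(s≤s _) = ⊔-pres-<m u<v (⌊n/2⌋<n _)

climb-positive : ∀ {u v} → 1 ≤ v → v < u → 1 ≤ ⌊ u /2⌋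
climb-positive {suc (suc u)} _ _ = s≤s z≤n
climb-positive {suc zero} (s≤s z≤n) (s≤s ())

widenˡ : ∀ u v {xs} → All (_≤ ⌊ u /2⌋ ⊔ v) xs → All (_≤ u ⊔ v) xs
widenˡ u v = All.map (λ y≤ → ≤-trans y≤ (⊔-monoˡ-≤ v (⌊n/2⌋≤n u)))

widenʳ : ∀ u v {xs} → All (_≤ u ⊔ ⌊ v /2⌋) xs → All (_≤ u ⊔ v) xs
widenʳ u v = All.map (λ y≤ → ≤-trans y≤ (⊔-monoʳ-≤ u (⌊n/2⌋≤n v)))

vertices-bounded : ∀ {u v} (r : Route u v) → All (_≤ u ⊔ v) (u ∷ vertices r)
vertices-bounded {u}     meet           = m≤m⊔n u u ∷ []
vertices-bounded {u} {v} (climbˡ v<u r) = m≤m⊔n u v ∷ widenˡ u v (vertices-bounded r)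
vertices-bounded {u} {v} (climbʳ u<v r) = ∷ʳ⁺ (widenʳ u v (vertices-bounded r)) (m≤n⊔m u v)

vertices-positive : ∀ {u v} → 1 ≤ u → 1 ≤ v → (r : Route u v) → All (1 ≤_) (u ∷ vertices r)
vertices-positive 1≤u 1≤v meet           = 1≤u ∷ []
vertices-positive 1≤u 1≤v (climbˡ v<u r) = 1≤u ∷ vertices-positive (climb-positive 1≤v v<u) 1≤v r
vertices-positive 1≤u 1≤v (climbʳ u<v r) = ∷ʳ⁺ (vertices-positive 1≤u (climb-positive 1≤u u<v) r) 1≤v

lowerEnds-bounded : ∀ {u v} (r : Route u v) → All (_≤ u ⊔ v) (lowerEnds r)
lowerEnds-bounded         meet           = []
lowerEnds-bounded {u} {v} (climbˡ v<u r) = m≤m⊔n u v ∷ widenˡ u v (lowerEnds-bounded r)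
lowerEnds-bounded {u} {v} (climbʳ u<v r) = ∷ʳ⁺ (widenʳ u v (lowerEnds-bounded r)) (m≤n⊔m u v)

unique-∷ : ∀ {b x xs} → All (_≤ b) xs → b < x → Unique xs → Unique (x ∷ xs)
unique-∷ below b<x uniq = All.map (λ y≤b → >⇒≢ (≤-<-trans y≤b b<x)) below ∷ uniq

unique-∷ʳ : ∀ {b x xs} → All (_≤ b) xs → b < x → Unique xs → Unique (xs ++ x ∷ [])
unique-∷ʳ below b<x uniq = ++⁺ uniq ([] ∷ []) λ where
  (y∈xs , here refl) → <⇒≢ (≤-<-trans (lookup below y∈xs) b<x) refl

vertices-unique : ∀ {u v} (r : Route u v) → Unique (u ∷ vertices r)
vertices-unique meet           = [] ∷ []
vertices-unique (climbˡ v<u r) = unique-∷ (vertices-bounded r) (climbˡ-below v<u) (vertices-unique r)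
vertices-unique (climbʳ u<v r) = unique-∷ʳ (vertices-bounded r) (climbʳ-below u<v) (vertices-unique r)

lowerEnds-unique : ∀ {u v} (r : Route u v) → Unique (lowerEnds r)
lowerEnds-unique meet           = []
lowerEnds-unique (climbˡ v<u r) = unique-∷ (lowerEnds-bounded r) (climbˡ-below v<u) (lowerEnds-unique r)
lowerEnds-unique (climbʳ u<v r) = unique-∷ʳ (lowerEnds-bounded r) (climbʳ-below u<v) (lowerEnds-unique r)

meetingPoint-≼ : ∀ {u v} (r : Route u v) → meetingPoint r ≼ u × meetingPoint r ≼ v
meetingPoint-≼ meet = (0 , refl) , (0 , refl)
meetingPoint-≼ (climbˡ _ r) with meetingPoint-≼ r
... | (i , up) , right = (suc i , up) , right
meetingPoint-≼ (climbʳ _ r) with meetingPoint-≼ r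
... | left , (i , up) = left , (suc i , up)

meetingPoint-positive : ∀ {u v} → 1 ≤ u → 1 ≤ v → (r : Route u v) → 1 ≤ meetingPoint r
meetingPoint-positive 1≤u 1≤v meet           = 1≤u
meetingPoint-positive 1≤u 1≤v (climbˡ v<u r) = meetingPoint-positive (climb-positive 1≤v v<u) 1≤v r
meetingPoint-positive 1≤u 1≤v (climbʳ u<v r) = meetingPoint-positive 1≤u (climb-positive 1≤u u<v) r

lowerEnds-below : ∀ {u v} (r : Route u v) → All (λ y → meetingPoint r ≼ ⌊ y /2⌋) (lowerEnds r)
lowerEnds-below meet         = []
lowerEnds-below (climbˡ _ r) = proj₁ (meetingPoint-≼ r) ∷ lowerEnds-below r
lowerEnds-below (climbʳ _ r) = ∷ʳ⁺ (lowerEnds-below r) (proj₂ (meetingPoint-≼ r))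

loop-meets : ∀ {u} (r : Route u u) → meetingPoint r ≡ u
loop-meets meet           = refl
loop-meets (climbˡ u<u _) = ⊥-elim (<-irrefl refl u<u)
loop-meets (climbʳ u<u _) = ⊥-elim (<-irrefl refl u<u)

meetingPoint-child : ∀ {u v} (r : Route u v) → u ≢ v → ∃[ w ] w ∈ lowerEnds r × ⌊ w /2⌋ ≡ meetingPoint r
meetingPoint-child meet u≢u = ⊥-elim (u≢u refl)
meetingPoint-child {u} {v} (climbˡ _ r) _ with ⌊ u /2⌋ ≟ v
... | yes refl = u , here refl , sym (loop-meets r)
... | no  u/2≢v with meetingPoint-child r u/2≢v
...   | w , w∈ , child = w , there w∈ , child
meetingPoint-child {u} {v} (climbʳ _ r) _ with u ≟ ⌊ v /2⌋
... | yes refl = v , ∈-++⁺ʳ (lowerEnds r) (here refl) , sym (loop-meets r)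
... | no  u≢v/2 with meetingPoint-child r u≢v/2
...   | w , w∈ , child = w , ∈-++⁺ˡ w∈ , child

colourCode : ℕ → Parity → ℕ
colourCode d 0ℙ = 2 * d
colourCode d 1ℙ = suc (2 * d)

colourCode-injective : ∀ {d d′ p p′} → colourCode d p ≡ colourCode d′ p′ → d ≡ d′ × p ≡ p′
colourCode-injective {d} {d′} {0ℙ} {0ℙ} eq = *-cancelˡ-≡ d d′ 2 eq , refl
colourCode-injective {d} {d′} {1ℙ} {1ℙ} eq = *-cancelˡ-≡ d d′ 2 (suc-injective eq) , refl
colourCode-injective {d} {d′} {0ℙ} {1ℙ} eq = ⊥-elim (even≢odd d d′ eq)
colourCode-injective {d} {d′} {1ℙ} {0ℙ} eq = ⊥-elim (even≢odd d′ d (sym eq))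

colourCode-< : ∀ d p → colourCode d p < 2 * suc d
colourCode-< d 0ℙ = ≤-trans (n<1+n (2 * d)) (≤-trans (n≤1+n _) (≤-reflexive (sym (*-suc 2 d))))
colourCode-< d 1ℙ = ≤-trans (n<1+n (suc (2 * d))) (≤-reflexive (sym (*-suc 2 d)))

edgeCode : ℕ → ℕ
edgeCode y = colourCode (depth ⌊ y /2⌋) (parity y)

-- Every lower end y has its parent below the meeting point L; an equal colour number puts that
-- parent at the depth of L, so y is a child of L of the same parity as w, i.e. y = w.
route-unique-code : ∀ {u v} (r : Route u v) → 1 ≤ u → 1 ≤ v → u ≢ v →
  ∃[ w ] w ∈ lowerEnds r × (∀ {y} → y ∈ lowerEnds r → edgeCode y ≡ edgeCode w → y ≡ w)
route-unique-code r 1≤u 1≤v u≢v with meetingPoint-child r u≢v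
... | w , w∈ , w-child = w , w∈ , unique
  where
    L = meetingPoint r

    unique : ∀ {y} → y ∈ lowerEnds r → edgeCode y ≡ edgeCode w → y ≡ w
    unique {y} y∈ same-code with colourCode-injective same-code
    ... | same-depth , same-parity =
      siblings-equal {L} (subst (λ a → ChildOf a y) y-child (child-of-half y))
                         (subst (λ a → ChildOf a w) w-child (child-of-half w)) same-parity
      where
        y-child : ⌊ y /2⌋ ≡ L
        y-child with lookup (lowerEnds-below r) y∈
        ... | i , y-below = ancestor-same-depth ⌊ y /2⌋ i (meetingPoint-positive 1≤u 1≤v r) y-below
                              (trans same-depth (cong depth w-child))

clamp : ∀ {size} → 0 < size → ℕ → Fin size
clamp {size} nonempty x with x <? size
... | yes x<size = fromℕ< x<size
... | no  _      = fromℕ< nonempty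

toℕ-clamp : ∀ {size} (nonempty : 0 < size) {x} → x < size → toℕ (clamp nonempty x) ≡ x
toℕ-clamp {size} nonempty {x} x<size with x <? size
... | yes x<size′ = toℕ-fromℕ< x<size′
... | no  x≮size  = ⊥-elim (x≮size x<size)

module HeapVertices (k : ℕ) (1≤k : 1 ≤ k) where

  N : ℕ
  N = 2 ^ k ∸ 1

  N-positive : 0 < N
  N-positive = m<n⇒0<n∸m (^-monoʳ-≤ 2 1≤k)

  label : Fin N → ℕ
  label i = suc (toℕ i)

  vertexAt : ℕ → Fin N
  vertexAt x = clamp N-positive (x ∸ 1)

  InTree : ℕ → Set
  InTree x = 1 ≤ x × x ≤ N

  label-inTree : ∀ i → InTree (label i)
  label-inTree i = s≤s z≤n , toℕ<n i

  label-vertexAt : ∀ {x} → InTree x → label (vertexAt x) ≡ x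
  label-vertexAt {suc x} (_ , x<N) = cong suc (toℕ-clamp N-positive x<N)

  vertexAt-label : ∀ i → vertexAt (label i) ≡ i
  vertexAt-label i = toℕ-injective (toℕ-clamp N-positive (toℕ<n i))

  parent-edge : ∀ {a b} → InTree a → InTree b → ChildOf a b → Adj (BinTree k) (vertexAt a) (vertexAt b)
  parent-edge a∈ b∈ child = inj₁ (subst₂ ChildOf (sym (label-vertexAt a∈)) (sym (label-vertexAt b∈)) child)

  vertexAt-injective : ∀ {x y} → InTree x → InTree y → vertexAt x ≡ vertexAt y → x ≡ y
  vertexAt-injective x∈ y∈ same = trans (sym (label-vertexAt x∈)) (trans (cong label same) (label-vertexAt y∈))

module TreePotential (k : ℕ) (1≤k : 1 ≤ k) {m : ℕ}
                     (col : Fin (2 ^ k ∸ 1) → Fin (2 ^ k ∸ 1) → Fin m) where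
  open HeapVertices k 1≤k

  rootParity : ℕ → ℕ → Fin m → Parity
  rootParity x zero    c = 0ℙ
  rootParity x (suc t) c = indicator c (col (vertexAt ⌊ x /2⌋) (vertexAt x)) ⊕ rootParity ⌊ x /2⌋ t c

  potential : Fin N → Fin m → Parity
  potential i = rootParity (label i) (depth (label i))

  rootParity-child : ∀ {a b} → 1 ≤ a → ChildOf a b → ∀ c →
    rootParity b (depth b) c ≡ indicator c (col (vertexAt a) (vertexAt b)) ⊕ rootParity a (depth a) c
  rootParity-child {a} {b} 1≤a child c = begin
    rootParity b (depth b) c
      ≡⟨ cong (λ d → rootParity b d c) (depth-half (half-positive (subst (1 ≤_) (sym parent) 1≤a))) ⟩
    indicator c (col (vertexAt ⌊ b /2⌋) (vertexAt b)) ⊕ rootParity ⌊ b /2⌋ (depth ⌊ b /2⌋) c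
      ≡⟨ cong (λ a → indicator c (col (vertexAt a) (vertexAt b)) ⊕ rootParity a (depth a) c) parent ⟩
    indicator c (col (vertexAt a) (vertexAt b)) ⊕ rootParity a (depth a) c ∎
    where
      open ≡-Reasoning
      parent : ⌊ b /2⌋ ≡ a
      parent = half-of-child a child

  potential-down : ∀ {u w} → ChildOf (label u) (label w) → ∀ c →
                   indicator c (col u w) ≡ potential u c ⊕ potential w c
  potential-down {u} {w} child c = ⊕-solve (begin
    potential w c
      ≡⟨ rootParity-child (s≤s z≤n) child c ⟩
    indicator c (col (vertexAt (label u)) (vertexAt (label w))) ⊕ potential u c
      ≡⟨ cong₂ (λ u′ w′ → indicator c (col u′ w′) ⊕ potential u c) (vertexAt-label u) (vertexAt-label w) ⟩
    indicator c (col u w) ⊕ potential u c ∎)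
    where open ≡-Reasoning

  tree-potential : (∀ u v → col u v ≡ col v u) → Potential (BinTree k) col potential
  tree-potential symmetric         (inj₁ down) c = potential-down down c
  tree-potential symmetric {u} {w} (inj₂ up)   c = begin
    indicator c (col u w)         ≡⟨ cong (indicator c) (symmetric u w) ⟩
    indicator c (col w u)         ≡⟨ potential-down up c ⟩
    potential w c ⊕ potential u c ≡⟨ ℙ.+-comm (potential w c) (potential u c) ⟩
    potential u c ⊕ potential w c ∎
    where open ≡-Reasoning

more-vertices-than-potentials : ∀ {k m} → 2 ≤ k → m < k → 2 ^ m < 2 ^ k ∸ 1
more-vertices-than-potentials {suc k} {m} (s≤s 1≤k) (s≤s m≤k) =
  ≤-<-trans (^-monoʳ-≤ 2 m≤k) (m+n≤o⇒m≤o∸n (suc p) (begin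
    suc p + 1 ≡⟨ +-comm (suc p) 1 ⟩
    2 + p     ≤⟨ +-monoˡ-≤ p (^-monoʳ-≤ 2 1≤k) ⟩
    p + p     ≡⟨ cong (p +_) (+-identityʳ p) ⟨
    2 * p     ∎))
  where
    open ≤-Reasoning
    p = 2 ^ k

heap-lower-bound : ∀ k → 2 ≤ k → ∀ m → m < k → ¬ CFColorable (BinTree k) m
heap-lower-bound k 2≤k m m<k =
  potential-lower-bound (BinTree k) m (more-vertices-than-potentials 2≤k m<k)
    λ col symmetric → let open TreePotential k (≤-trans (s≤s z≤n) 2≤k) col
                      in potential , tree-potential symmetric

module HeapColouring (j : ℕ) where
  k : ℕ
  k = suc (suc j)

  open HeapVertices k (s≤s z≤n)

  M : ℕ
  M = 2 * k ∸ 2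

  M≡ : M ≡ 2 * suc j
  M≡ = sym (*-distribˡ-∸ 2 k 1)

  M-positive : 0 < M
  M-positive = subst (0 <_) (sym M≡) (s≤s z≤n)

  edgeCode-< : ∀ {y} → y ≤ N → edgeCode y < M
  edgeCode-< {y} y≤N = subst (edgeCode y <_) (sym M≡) (begin-strict
    edgeCode y                              <⟨ colourCode-< (depth ⌊ y /2⌋) (parity y) ⟩
    2 * suc (depth ⌊ y /2⌋)                 ≡⟨ cong (λ d → 2 * suc d) (⌊log₂⌊n/2⌋⌋≡⌊log₂n⌋∸1 y) ⟩
    2 * suc (depth y ∸ 1)                   ≤⟨ *-monoʳ-≤ 2 (s≤s (∸-monoˡ-≤ 1 (depth-bound (suc j) y y<2^k))) ⟩
    2 * suc j                               ∎)
    where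
      open ≤-Reasoning
      y<2^k : y < 2 ^ k
      y<2^k = subst (_≤ 2 ^ k) (+-comm y 1) (m≤o∸n⇒m+n≤o y (m^n>0 2 k) y≤N)

  colourOf : ℕ → Fin M
  colourOf y = clamp M-positive (edgeCode y)

  colourOf-injective : ∀ {y y′} → y ≤ N → y′ ≤ N → colourOf y ≡ colourOf y′ → edgeCode y ≡ edgeCode y′
  colourOf-injective y≤N y′≤N same =
    trans (sym (toℕ-clamp M-positive (edgeCode-< y≤N)))
          (trans (cong toℕ same) (toℕ-clamp M-positive (edgeCode-< y′≤N)))

  -- The edge between labels a and b (one the parent of the other) is coloured by the child.
  colouring : Fin N → Fin N → Fin M
  colouring i i′ = colourOf (label i ⊔ label i′)

  colouring-symmetric : ∀ i i′ → colouring i i′ ≡ colouring i′ i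
  colouring-symmetric i i′ = cong colourOf (⊔-comm (label i) (label i′))

  colouring-labels : ∀ {a b} → InTree a → InTree b → colouring (vertexAt a) (vertexAt b) ≡ colourOf (a ⊔ b)
  colouring-labels a∈ b∈ = cong colourOf (cong₂ _⊔_ (label-vertexAt a∈) (label-vertexAt b∈))

  climb-inTree : ∀ {u v} → InTree v → v < u → InTree u → InTree ⌊ u /2⌋
  climb-inTree (1≤v , _) v<u (_ , u≤N) = climb-positive 1≤v v<u , ≤-trans (⌊n/2⌋≤n _) u≤N

  path : ∀ {u v} → Route u v → List (Fin N)
  path r = map vertexAt (vertices r)

  path-∷ʳ : ∀ {u v} (r : Route u ⌊ v /2⌋) → map vertexAt (vertices r ++ v ∷ []) ≡ path r ++ vertexAt v ∷ []
  path-∷ʳ {v = v} r = map-++ vertexAt (vertices r) (v ∷ [])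

  path-endpoint : ∀ {u v} (r : Route u v) → endpoint (vertexAt u) (path r) ≡ vertexAt v
  path-endpoint meet           = refl
  path-endpoint (climbˡ _ r)   = path-endpoint r
  path-endpoint {u} {v} (climbʳ _ r) = begin
    endpoint (vertexAt u) (map vertexAt (vertices r ++ v ∷ []))    ≡⟨ cong (endpoint (vertexAt u)) (path-∷ʳ r) ⟩
    endpoint (vertexAt u) (path r ++ vertexAt v ∷ [])                ≡⟨ endpoint-++ (vertexAt u) (path r) _ ⟩
    endpoint (endpoint (vertexAt u) (path r)) (vertexAt v ∷ [])      ≡⟨⟩
    vertexAt v                                                       ∎
    where open ≡-Reasoning

  path-walk : ∀ {u v} → InTree u → InTree v → (r : Route u v) → Walk (BinTree k) (vertexAt u) (path r)
  path-walk u∈ v∈ meet           = stop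
  path-walk u∈ v∈ (climbˡ {u} v<u r) =
    step (swap (parent-edge up∈ u∈ (child-of-half u))) (path-walk up∈ v∈ r)
    where up∈ = climb-inTree v∈ v<u u∈
  path-walk {u} u∈ v∈ (climbʳ {v = v} u<v r) =
    subst (Walk (BinTree k) (vertexAt u)) (sym (path-∷ʳ r))
      (walk-++ (path r) (path-walk u∈ vp∈ r)
         (subst (λ x → Walk (BinTree k) x (vertexAt v ∷ [])) (sym (path-endpoint r))
            (step (parent-edge vp∈ v∈ (child-of-half v)) stop)))
    where vp∈ = climb-inTree u∈ u<v v∈

  path-colours : ∀ {u v} → InTree u → InTree v → (r : Route u v) →
                 edgeColours colouring (vertexAt u) (path r) ≡ map colourOf (lowerEnds r)
  path-colours u∈ v∈ meet = refl
  path-colours u∈ v∈ (climbˡ {u} v<u r) = cong₂ _∷_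
    (trans (colouring-labels u∈ up∈) (cong colourOf (m≥n⇒m⊔n≡m (⌊n/2⌋≤n u))))
    (path-colours up∈ v∈ r)
    where up∈ = climb-inTree v∈ v<u u∈
  path-colours {u} u∈ v∈ (climbʳ {v = v} u<v r) = begin
    edgeColours colouring (vertexAt u) (map vertexAt (vertices r ++ v ∷ []))
      ≡⟨ cong (edgeColours colouring (vertexAt u)) (path-∷ʳ r) ⟩
    edgeColours colouring (vertexAt u) (path r ++ vertexAt v ∷ [])
      ≡⟨ edgeColours-++ colouring (vertexAt u) (path r) _ ⟩
    edgeColours colouring (vertexAt u) (path r) ++ colouring (endpoint (vertexAt u) (path r)) (vertexAt v) ∷ []
      ≡⟨ cong₂ (λ cs x → cs ++ colouring x (vertexAt v) ∷ []) (path-colours u∈ vp∈ r) (path-endpoint r) ⟩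
    map colourOf (lowerEnds r) ++ colouring (vertexAt ⌊ v /2⌋) (vertexAt v) ∷ []
      ≡⟨ cong (λ c → map colourOf (lowerEnds r) ++ c ∷ [])
              (trans (colouring-labels vp∈ v∈) (cong colourOf (m≤n⇒m⊔n≡n (⌊n/2⌋≤n v)))) ⟩
    map colourOf (lowerEnds r) ++ map colourOf (v ∷ [])
      ≡⟨ map-++ colourOf (lowerEnds r) (v ∷ []) ⟨
    map colourOf (lowerEnds r ++ v ∷ []) ∎
    where
      open ≡-Reasoning
      vp∈ = climb-inTree u∈ u<v v∈

  CFPath : Fin N → Fin N → Set
  CFPath i i′ = Σ (List (Fin N)) λ ws → IsPath (BinTree k) i ws i′ × ConflictFree colouring i ws

  connect : ∀ {u v} → InTree u → InTree v → u ≢ v → CFPath (vertexAt u) (vertexAt v)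
  connect {u} {v} u∈@(1≤u , u≤N) v∈@(1≤v , v≤N) u≢v
    with route-unique-code (route u v) 1≤u 1≤v u≢v
  ... | w , w∈ , only = path r , (path-walk u∈ v∈ r , path-unique , path-endpoint r) , colourOf w , colour-once
    where
      r = route u v
      u⊔v≤N : u ⊔ v ≤ N
      u⊔v≤N = ⊔-lub u≤N v≤N

      path-unique : Unique (vertexAt u ∷ path r)
      path-unique = unique-map vertexAt vertexAt-injective
        (All.zipWith (λ (1≤y , y≤) → 1≤y , ≤-trans y≤ u⊔v≤N)
                     (vertices-positive 1≤u 1≤v r , vertices-bounded r))
        (vertices-unique r)

      colour-once : occ (colourOf w) (edgeColours colouring (vertexAt u) (path r)) ≡ 1
      colour-once = trans (cong (occ (colourOf w)) (path-colours u∈ v∈ r))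
        (occ-once colourOf (lowerEnds r) (lowerEnds-unique r) w∈ λ y∈ same →
           only y∈ (colourOf-injective (in-range y∈) (in-range w∈) same))
        where
          in-range : ∀ {y} → y ∈ lowerEnds r → y ≤ N
          in-range y∈ = ≤-trans (lookup (lowerEnds-bounded r) y∈) u⊔v≤N

  heap-upper-bound : CFColorable (BinTree k) M
  heap-upper-bound = colouring , colouring-symmetric , connected
    where
      connected : ∀ i i′ → i ≢ i′ → CFPath i i′
      connected i i′ i≢i′ =
        subst₂ CFPath (vertexAt-label i) (vertexAt-label i′)
          (connect (label-inTree i) (label-inTree i′) (λ same → i≢i′ (toℕ-injective (suc-injective same))))

corollary3p6 : (k : ℕ) → 2 ≤ k →
    ((m : ℕ) → m < k → ¬ CFColorable (BinTree k) m) × CFColorable (BinTree k) (2 * k ∸ 2)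
corollary3p6 k@(suc (suc j)) 2≤k = heap-lower-bound k 2≤k , HeapColouring.heap-upper-bound j
corollary3p6 (suc zero) (s≤s ())
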